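{- (i) A $\mathcal V$-dcpo $D$ has a small basis if and only if it is isomorphic to $\mathrm{Idl}_{\mathcal V}(B,\prec)$ for some abstract $\mathcal V$-basis $(B,\prec)$. (ii) A $\mathcal V$-dcpo $D$ has a small compact basis if and only if it is isomorphic to $\mathrm{Idl}_{\mathcal V}(B,\prec)$ for some abstract $\mathcal V$-basis $(B,\prec)$ with $\prec$ reflexive. In particular, every $\mathcal V$-dcpo with a small basis is isomorphic to one whose order takes values in $\mathcal V$ and whose carrier lives in $\mathcal V^+$.
   Context: Setting: intensional Martin-Löf type theory with universes, function extensionality, propositional extensionality and propositional truncations. A $\mathcal V$-dcpo is a poset (proposition-valued reflexive transitive antisymmetric order, carrier and order in arbitrary universes) in which every directed family (inhabited index, any two indices have an upper bound index, truncated existence) indexed by a type in $\mathcal V$ has a supremum. Isomorphism means a Scott continuous map (preserving such suprema) with Scott continuous inverse. $x\ll y$ if for every directed $\alpha:I\to D$ with $I:\mathcal V$ and $y\sqsubseteq\bigsqcup\alpha$ there exists $i$ with $x\sqsubseteq\alpha_i$; $x$ is compact if $x\ll x$. A small basis is $\beta:B\to D$ with $B:\mathcal V$ such that each $\beta(b)\ll x$ is $\mathcal V$-small and for each $x$ the family $\Sigma_{b:B}(\beta(b)\ll x)\to D$, $(b,\_)\mapsto\beta(b)$, is directed with supremum $x$. A small compact basis is $\beta:B\to D$ with $B:\mathcal V$, all $\beta(b)$ compact, each $\beta(b)\sqsubseteq x$ $\mathcal V$-small, and each family $\Sigma_{b:B}(\beta(b)\sqsubseteq x)\to D$ directed with supremum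 $x$. An abstract $\mathcal V$-basis is $B:\mathcal V$ with a proposition-valued transitive $\prec:B\to B\to\mathcal V$ such that every $a$ has some $b\prec a$, and whenever $a_1,a_2\prec b$ there exists $a$ with $a_1,a_2\prec a\prec b$. Ideals are inhabited, semidirected lower subsets $B\to\Omega_{\mathcal V}$; $\mathrm{Idl}_{\mathcal V}(B,\prec)$ is the $\mathcal V$-dcpo of ideals ordered by inclusion with unions as directed suprema. -}

module Defs where

open import Level using (Level; _⊔_; Setω) renaming (suc to lsuc)
open import Data.Product using (Σ; Σ-syntax; _×_; _,_; proj₁; proj₂)
open import Relation.Binary.PropositionalEquality using (_≡_; refl; sym; trans; cong)
open import Relation.Binary.PropositionalEquality.Properties using (trans-symˡ)
open import Function.Base using (_∘_)
open import Function.Bundles using (_↔_; _⇔_)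

isProp : ∀ {a} → Set a → Set a
isProp A = (x y : A) → x ≡ y

record PropTrunc : Setω where
  field
    ∥_∥      : ∀ {a} → Set a → Set a
    ∥∥-isProp : ∀ {a} {A : Set a} → isProp ∥ A ∥
    ∣_∣      : ∀ {a} {A : Set a} → A → ∥ A ∥
    ∥∥-rec   : ∀ {a b} {A : Set a} {P : Set b} → isProp P → (A → P) → ∥ A ∥ → P

FunExt : Setω
FunExt = ∀ {a b} {A : Set a} {B : A → Set b} {f g : (x : A) → B x}
         → (∀ x → f x ≡ g x) → f ≡ g

PropExt : Setω
PropExt = ∀ {a} {P Q : Set a} → isProp P → isProp Q → (P → Q) → (Q → P) → P ≡ Q

module _ {a} {A : Set a} (p : isProp A) where
  private
    canon : ∀ {x y} (q : x ≡ y) → q ≡ trans (sym (p x x)) (p x y)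
    canon {x} refl = sym (trans-symˡ (p x x))

  isProp→isSet : ∀ {x y} (q r : x ≡ y) → q ≡ r
  isProp→isSet q r = trans (canon q) (sym (canon r))

Σ-prop-≡ : ∀ {a b} {A : Set a} {B : A → Set b} → (∀ x → isProp (B x))
         → {u v : Σ A B} → proj₁ u ≡ proj₁ v → u ≡ v
Σ-prop-≡ h {x , p} {.x , q} refl = cong (x ,_) (h x p q)

module WithAx (pt : PropTrunc) (fe : FunExt) (pe : PropExt) where
  open PropTrunc pt public

  ∃∥ : ∀ {a b} {A : Set a} → (A → Set b) → Set (a ⊔ b)
  ∃∥ {A = A} P = ∥ Σ A P ∥

  ∥∥-map : ∀ {a b} {A : Set a} {C : Set b} → (A → C) → ∥ A ∥ → ∥ C ∥
  ∥∥-map f = ∥∥-rec ∥∥-isProp (∣_∣ ∘ f)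

  ∥∥-bind : ∀ {a b} {A : Set a} {C : Set b} → (A → ∥ C ∥) → ∥ A ∥ → ∥ C ∥
  ∥∥-bind f = ∥∥-rec ∥∥-isProp f

  isProp-isProp : ∀ {a} {A : Set a} → isProp (isProp A)
  isProp-isProp p q = fe λ x → fe λ y → isProp→isSet p (p x y) (q x y)

  isProp-Π : ∀ {a b} {A : Set a} {B : A → Set b}
           → (∀ x → isProp (B x)) → isProp ((x : A) → B x)
  isProp-Π h f g = fe λ x → h x (f x) (g x)

  isProp-× : ∀ {a b} {A : Set a} {B : Set b} → isProp A → isProp B → isProp (A × B)
  isProp-× pA pB (x , y) (x' , y') with pA x x' | pB y y'
  ... | refl | refl = refl

  is-small : ∀ {a} (V : Level) → Set a → Set (lsuc V ⊔ a)
  is-small V X = Σ (Set V) λ Y → Y ↔ X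

  module _ {𝓤 𝓣} {C : Set 𝓤} (_⊑_ : C → C → Set 𝓣) where
    is-semidirected : ∀ {𝓘} {I : Set 𝓘} → (I → C) → Set (𝓘 ⊔ 𝓣)
    is-semidirected {I = I} α = (i j : I) → ∃∥ λ k → (α i ⊑ α k) × (α j ⊑ α k)

    is-directed : ∀ {𝓘} {I : Set 𝓘} → (I → C) → Set (𝓘 ⊔ 𝓣)
    is-directed {I = I} α = ∥ I ∥ × is-semidirected α

    is-upperbound : ∀ {𝓘} {I : Set 𝓘} → C → (I → C) → Set (𝓘 ⊔ 𝓣)
    is-upperbound x α = ∀ i → α i ⊑ x

    is-sup : ∀ {𝓘} {I : Set 𝓘} → C → (I → C) → Set (𝓘 ⊔ 𝓤 ⊔ 𝓣)
    is-sup x α = is-upperbound x α × (∀ y → is-upperbound y α → x ⊑ y)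

  record Dcpo (V 𝓤 𝓣 : Level) : Set (lsuc (V ⊔ 𝓤 ⊔ 𝓣)) where
    field
      Carrier   : Set 𝓤
      _⊑_       : Carrier → Carrier → Set 𝓣
      ⊑-prop    : ∀ x y → isProp (x ⊑ y)
      ⊑-refl    : ∀ x → x ⊑ x
      ⊑-trans   : ∀ x y z → x ⊑ y → y ⊑ z → x ⊑ z
      ⊑-antisym : ∀ x y → x ⊑ y → y ⊑ x → x ≡ y
      ∐         : {I : Set V} (α : I → Carrier) → is-directed _⊑_ α → Carrier
      ∐-is-sup  : {I : Set V} (α : I → Carrier) (δ : is-directed _⊑_ α)
                  → is-sup _⊑_ (∐ α δ) α

  ⟨_⟩ : ∀ {V 𝓤 𝓣} → Dcpo V 𝓤 𝓣 → Set 𝓤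
  ⟨ D ⟩ = Dcpo.Carrier D

  is-continuous : ∀ {V 𝓤 𝓣 𝓤' 𝓣'} (D : Dcpo V 𝓤 𝓣) (E : Dcpo V 𝓤' 𝓣')
                → (⟨ D ⟩ → ⟨ E ⟩) → Set (lsuc V ⊔ 𝓤 ⊔ 𝓣 ⊔ 𝓤' ⊔ 𝓣')
  is-continuous {V} D E f =
    {I : Set V} (α : I → ⟨ D ⟩) (δ : is-directed (Dcpo._⊑_ D) α)
    → is-sup (Dcpo._⊑_ E) (f (Dcpo.∐ D α δ)) (f ∘ α)

  _≅ᵈᶜᵖᵒ_ : ∀ {V 𝓤 𝓣 𝓤' 𝓣'} → Dcpo V 𝓤 𝓣 → Dcpo V 𝓤' 𝓣'
          → Set (lsuc V ⊔ 𝓤 ⊔ 𝓣 ⊔ 𝓤' ⊔ 𝓣')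
  D ≅ᵈᶜᵖᵒ E = Σ (⟨ D ⟩ → ⟨ E ⟩) λ f → Σ (⟨ E ⟩ → ⟨ D ⟩) λ g →
              (∀ x → g (f x) ≡ x) × (∀ y → f (g y) ≡ y)
              × is-continuous D E f × is-continuous E D g

  module _ {V 𝓤 𝓣} (D : Dcpo V 𝓤 𝓣) where
    open Dcpo D

    way-below : Carrier → Carrier → Set (lsuc V ⊔ 𝓤 ⊔ 𝓣)
    way-below x y = {I : Set V} (α : I → Carrier) (δ : is-directed _⊑_ α)
                    → y ⊑ ∐ α δ → ∃∥ λ i → x ⊑ α i

    is-compact : Carrier → Set (lsuc V ⊔ 𝓤 ⊔ 𝓣)
    is-compact x = way-below x x

    is-small-basis : {B : Set V} → (B → Carrier) → Set (lsuc V ⊔ 𝓤 ⊔ 𝓣)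
    is-small-basis {B} β =
        (∀ b x → is-small V (way-below (β b) x))
      × (∀ x → is-directed _⊑_ (↡ι x))
      × (∀ x → is-sup _⊑_ x (↡ι x))
      where
        ↡ι : (x : Carrier) → Σ B (λ b → way-below (β b) x) → Carrier
        ↡ι x (b , _) = β b

    has-small-basis : Set (lsuc V ⊔ 𝓤 ⊔ 𝓣)
    has-small-basis = ∃∥ λ (B : Set V) → Σ (B → Carrier) is-small-basis

    is-small-compact-basis : {B : Set V} → (B → Carrier) → Set (lsuc V ⊔ 𝓤 ⊔ 𝓣)
    is-small-compact-basis {B} β =
        (∀ b → is-compact (β b))
      × (∀ b x → is-small V (β b ⊑ x))
      × (∀ x → is-directed _⊑_ (↓ι x))
      × (∀ x → is-sup _⊑_ x (↓ι x))
      where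
        ↓ι : (x : Carrier) → Σ B (λ b → β b ⊑ x) → Carrier
        ↓ι x (b , _) = β b

    has-small-compact-basis : Set (lsuc V ⊔ 𝓤 ⊔ 𝓣)
    has-small-compact-basis = ∃∥ λ (B : Set V) → Σ (B → Carrier) is-small-compact-basis

  is-abstract-basis : ∀ {V} {B : Set V} → (B → B → Set V) → Set V
  is-abstract-basis {B = B} _≺_ =
      (∀ a b → isProp (a ≺ b))
    × (∀ a b c → a ≺ b → b ≺ c → a ≺ c)
    × (∀ a → ∃∥ λ b → b ≺ a)
    × (∀ a₁ a₂ b → a₁ ≺ b → a₂ ≺ b → ∃∥ λ a → (a₁ ≺ a) × (a₂ ≺ a) × (a ≺ b))

  module IdealCompletion {V} {B : Set V} (_≺_ : B → B → Set V) where
    Ω : Set (lsuc V)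
    Ω = Σ (Set V) isProp

    _∈_ : B → (B → Ω) → Set V
    b ∈ I = proj₁ (I b)

    is-lowerset : (B → Ω) → Set V
    is-lowerset I = ∀ a b → a ≺ b → b ∈ I → a ∈ I

    is-inhabited-set : (B → Ω) → Set V
    is-inhabited-set I = ∃∥ λ b → b ∈ I

    is-semidirected-set : (B → Ω) → Set V
    is-semidirected-set I = ∀ a b → a ∈ I → b ∈ I → ∃∥ λ c → (c ∈ I) × (a ≺ c) × (b ≺ c)

    is-ideal : (B → Ω) → Set V
    is-ideal I = is-lowerset I × is-inhabited-set I × is-semidirected-set I

    Idl : Set (lsuc V)
    Idl = Σ (B → Ω) is-ideal

    _⊆_ : Idl → Idl → Set V
    I ⊆ J = ∀ b → b ∈ proj₁ I → b ∈ proj₁ J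

    private
      mem-prop : (I : B → Ω) (b : B) → isProp (b ∈ I)
      mem-prop I b = proj₂ (I b)

      is-ideal-prop : (I : B → Ω) → isProp (is-ideal I)
      is-ideal-prop I =
        isProp-× (isProp-Π λ a → isProp-Π λ b → isProp-Π λ _ → isProp-Π λ _ → mem-prop I a)
          (isProp-× ∥∥-isProp
            (isProp-Π λ a → isProp-Π λ b → isProp-Π λ _ → isProp-Π λ _ → ∥∥-isProp))

      ⊆-prop : ∀ I J → isProp (I ⊆ J)
      ⊆-prop I J = isProp-Π λ b → isProp-Π λ _ → mem-prop (proj₁ J) b

      ⊆-antisym : ∀ I J → I ⊆ J → J ⊆ I → I ≡ J
      ⊆-antisym I J p q = Σ-prop-≡ is-ideal-prop
        (fe λ b → Σ-prop-≡ (λ _ → isProp-isProp)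
          (pe (mem-prop (proj₁ I) b) (mem-prop (proj₁ J) b) (p b) (q b)))

      module _ {I : Set V} (α : I → Idl) (δ : is-directed _⊆_ α) where
        ∪ : B → Ω
        ∪ b = (∃∥ λ i → b ∈ proj₁ (α i)) , ∥∥-isProp

        ∪-ideal : is-ideal ∪
        ∪-ideal = lower , inh , semi
          where
            lower : is-lowerset ∪
            lower a b r = ∥∥-map λ (i , m) → i , proj₁ (proj₂ (α i)) a b r m
            inh : is-inhabited-set ∪
            inh = ∥∥-bind (λ i → ∥∥-map (λ (b , m) → b , ∣ i , m ∣)
                                        (proj₁ (proj₂ (proj₂ (α i)))))
                          (proj₁ δ)
            semi : is-semidirected-set ∪
            semi a b ma mb =
              ∥∥-bind (λ (i , mi) → ∥∥-bind (λ (j , mj) →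
                ∥∥-bind (λ (k , ik , jk) →
                  ∥∥-map (λ (c , mc , ac , bc) → c , ∣ k , mc ∣ , ac , bc)
                         (proj₂ (proj₂ (proj₂ (α k))) a b (ik a mi) (jk b mj)))
                  (proj₂ δ i j)) mb) ma

        ∪-sup : is-sup _⊆_ (∪ , ∪-ideal) α
        ∪-sup = (λ i b m → ∣ i , m ∣)
              , (λ J ub b → ∥∥-rec (mem-prop (proj₁ J) b) (λ (i , m) → ub i b m))

    Idl-DCPO : Dcpo V (lsuc V) V
    Idl-DCPO = record
      { Carrier   = Idl
      ; _⊑_       = _⊆_
      ; ⊑-prop    = ⊆-prop
      ; ⊑-refl    = λ I b m → m
      ; ⊑-trans   = λ I J K p q b m → q b (p b m)
      ; ⊑-antisym = ⊆-antisym
      ; ∐         = λ α δ → ∪ α δ , ∪-ideal α δ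
      ; ∐-is-sup  = ∪-sup
      }

  open IdealCompletion using (Idl-DCPO) public

-- If β is a small basis of D, the relation a ≺ b :≡ β a ≪ β b (resized into V using the
-- smallness of ≪) is an abstract basis: interpolation holds because every x is the directed
-- supremum of the approximants of its approximants. The maps x ↦ {b | β b ≪ x} and
-- I ↦ ⨆_{b ∈ I} β b are mutually inverse and monotone, hence a dcpo isomorphism. Conversely
-- the principal ideals ↓b form a small basis of Idl(B, ≺), and small bases transfer along
-- isomorphisms. The compact case reduces to this one: for compact c, c ⊑ x iff c ≪ x, so a
-- small compact basis is a small basis of compact elements, which makes ≺ reflexive; and
-- when ≺ is reflexive every ↓b is compact.
module Submission where

open import Defs
open import Level using (Level; _⊔_; Lift; lift) renaming (suc to lsuc)
open import Data.Bool using (Bool; true; false)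
open import Data.Product using (Σ; _×_; _,_; proj₁; proj₂)
open import Data.Unit.Polymorphic using (⊤; tt)
open import Function.Base using (_∘_)
open import Function.Bundles using (_⇔_; _↔_; Equivalence; Inverse; mk↔ₛ′; mk⇔)
open import Function.Properties.Inverse using (↔-trans)
open import Relation.Binary.PropositionalEquality using (_≡_; sym; trans; cong; subst)

module DomainTheory (pt : PropTrunc) (fe : FunExt) (pe : PropExt) where
  open WithAx pt fe pe

  implicit-funext : ∀ {a b} {A : Set a} {B : A → Set b} {f g : {x : A} → B x}
                  → (∀ x → f {x} ≡ g {x}) → (λ {x} → f {x}) ≡ (λ {x} → g {x})
  implicit-funext {A = A} {B} h = cong (λ (h' : (x : A) → B x) {x} → h' x) (fe h)

  isProp-↔ : ∀ {a b} {A : Set a} {C : Set b} → A ↔ C → isProp C → isProp A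
  isProp-↔ e pC x y = trans (sym (Inverse.strictlyInverseʳ e x))
    (trans (cong (Inverse.from e) (pC _ _)) (Inverse.strictlyInverseʳ e y))

  prop-⇔→↔ : ∀ {a b} {A : Set a} {C : Set b}
           → isProp A → isProp C → (A → C) → (C → A) → A ↔ C
  prop-⇔→↔ pA pC to from = mk↔ₛ′ to from (λ _ → pC _ _) (λ _ → pA _ _)

  is-small-resp-⇔ : ∀ {V a b} {A : Set a} {C : Set b}
                  → is-small V A → isProp A → isProp C → (A → C) → (C → A) → is-small V C
  is-small-resp-⇔ (Y , e) pA pC to from = Y , ↔-trans e (prop-⇔→↔ pA pC to from)

  module _ {V 𝓤 𝓣} (D : Dcpo V 𝓤 𝓣) where
    open Dcpo D

    is-directed-sup : ∀ {𝓘} {I : Set 𝓘} → Carrier → (I → Carrier) → Set (𝓘 ⊔ 𝓤 ⊔ 𝓣)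
    is-directed-sup x α = is-directed _⊑_ α × is-sup _⊑_ x α

    ∐-unique : {I : Set V} (α : I → Carrier) (δ : is-directed _⊑_ α) {x : Carrier}
             → is-sup _⊑_ x α → ∐ α δ ≡ x
    ∐-unique α δ (ub , least) =
      ⊑-antisym _ _ (proj₂ (∐-is-sup α δ) _ ub) (least _ (proj₁ (∐-is-sup α δ)))

    _cofinal-in_ : ∀ {𝓘 𝓙} {I : Set 𝓘} {J : Set 𝓙} → (I → Carrier) → (J → Carrier)
                 → Set (𝓘 ⊔ 𝓙 ⊔ 𝓣)
    α cofinal-in α' = ∀ i → ∃∥ λ j → α i ⊑ α' j

    cofinal-directed-sup : ∀ {𝓘 𝓙} {I : Set 𝓘} {J : Set 𝓙} {α : I → Carrier} {α' : J → Carrier}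
                           {x : Carrier}
                         → is-directed-sup x α → α cofinal-in α' → α' cofinal-in α
                         → is-directed-sup x α'
    cofinal-directed-sup {α = α} {α'} ((inh , semi) , (ub , least)) c c' =
        (∥∥-bind (λ i → ∥∥-map proj₁ (c i)) inh , semi')
      , (λ j → ∥∥-rec (⊑-prop _ _) (λ (i , p) → ⊑-trans _ _ _ p (ub i)) (c' j))
      , (λ y ub' → least y λ i → ∥∥-rec (⊑-prop _ _) (λ (j , p) → ⊑-trans _ _ _ p (ub' j)) (c i))
      where
        semi' : is-semidirected _⊑_ α'
        semi' j₁ j₂ =
          ∥∥-bind (λ (i₁ , p₁) → ∥∥-bind (λ (i₂ , p₂) → ∥∥-bind (λ (i , q₁ , q₂) →
            ∥∥-map (λ (j , r) → j , ⊑-trans _ _ _ p₁ (⊑-trans _ _ _ q₁ r)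
                                  , ⊑-trans _ _ _ p₂ (⊑-trans _ _ _ q₂ r))
                   (c i))
            (semi i₁ i₂)) (c' j₂)) (c' j₁)

    Σ-directed-sup-⇔ : ∀ {𝓑 𝓟 𝓠} {B : Set 𝓑} {P : B → Set 𝓟} {Q : B → Set 𝓠}
                       (γ : B → Carrier) {x : Carrier}
                     → (∀ b → P b → Q b) → (∀ b → Q b → P b)
                     → is-directed-sup x (λ (p : Σ B P) → γ (proj₁ p))
                     → is-directed-sup x (λ (q : Σ B Q) → γ (proj₁ q))
    Σ-directed-sup-⇔ γ to from ds =
      cofinal-directed-sup ds (λ (b , p) → ∣ (b , to b p) , ⊑-refl _ ∣)
                           (λ (b , q) → ∣ (b , from b q) , ⊑-refl _ ∣)

    ≪-isProp : ∀ x y → isProp (way-below D x y)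
    ≪-isProp x y _ _ = implicit-funext λ I → fe λ α → fe λ δ → fe λ p → ∥∥-isProp _ _

    ≪⇒⊑ : ∀ {x y} → way-below D x y → x ⊑ y
    ≪⇒⊑ {x} {y} w =
      ∥∥-rec (⊑-prop x y) proj₂
        (w (λ (_ : ⊤) → y) (∣ tt ∣ , λ _ _ → ∣ tt , ⊑-refl y , ⊑-refl y ∣)
           (proj₁ (∐-is-sup _ _) tt))

    ≪-⊑-trans : ∀ {x y z} → way-below D x y → y ⊑ z → way-below D x z
    ≪-⊑-trans w p α δ q = w α δ (⊑-trans _ _ _ p q)

    ⊑-≪-trans : ∀ {x y z} → x ⊑ y → way-below D y z → way-below D x z
    ⊑-≪-trans p w α δ q = ∥∥-map (λ (i , r) → i , ⊑-trans _ _ _ p r) (w α δ q)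

  is-monotone : ∀ {V 𝓤 𝓣 𝓤' 𝓣'} (D : Dcpo V 𝓤 𝓣) (E : Dcpo V 𝓤' 𝓣')
              → (⟨ D ⟩ → ⟨ E ⟩) → Set (𝓤 ⊔ 𝓣 ⊔ 𝓣')
  is-monotone D E f = ∀ x y → Dcpo._⊑_ D x y → Dcpo._⊑_ E (f x) (f y)

  module _ {V 𝓤 𝓣 𝓤' 𝓣'} (D : Dcpo V 𝓤 𝓣) (E : Dcpo V 𝓤' 𝓣') where
    private
      module D = Dcpo D
      module E = Dcpo E

    -- Apply continuity to the directed family {x, y}, whose supremum is y.
    continuous⇒monotone : (f : ⟨ D ⟩ → ⟨ E ⟩) → is-continuous D E f → is-monotone D E f
    continuous⇒monotone f cf x y p =
      subst (λ z → f x E.⊑ f z) (∐-unique D α δ (ub , λ _ ub' → ub' (lift false)))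
            (proj₁ (cf α δ) (lift true))
      where
        α : Lift V Bool → ⟨ D ⟩
        α (lift true)  = x
        α (lift false) = y
        ub : ∀ i → α i D.⊑ y
        ub (lift true)  = p
        ub (lift false) = D.⊑-refl y
        δ : is-directed D._⊑_ α
        δ = ∣ lift true ∣ , λ i j → ∣ lift false , ub i , ub j ∣

    monotone-image-directed : (f : ⟨ D ⟩ → ⟨ E ⟩) → is-monotone D E f
                            → ∀ {𝓘} {I : Set 𝓘} (α : I → ⟨ D ⟩)
                            → is-directed D._⊑_ α → is-directed E._⊑_ (f ∘ α)
    monotone-image-directed f mf α (inh , semi) =
      inh , λ i j → ∥∥-map (λ (k , p , q) → k , mf _ _ p , mf _ _ q) (semi i j)

    record OrderIso : Set (𝓤 ⊔ 𝓣 ⊔ 𝓤' ⊔ 𝓣') where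
      field
        to        : ⟨ D ⟩ → ⟨ E ⟩
        from      : ⟨ E ⟩ → ⟨ D ⟩
        from-to   : ∀ x → from (to x) ≡ x
        to-from   : ∀ y → to (from y) ≡ y
        to-mono   : is-monotone D E to
        from-mono : is-monotone E D from

  module _ {V 𝓤 𝓣 𝓤' 𝓣'} {D : Dcpo V 𝓤 𝓣} {E : Dcpo V 𝓤' 𝓣'} where
    private
      module D = Dcpo D
      module E = Dcpo E
    open OrderIso

    OrderIso-sym : OrderIso D E → OrderIso E D
    OrderIso-sym φ = record { to = from φ ; from = to φ ; from-to = to-from φ
                            ; to-from = from-to φ ; to-mono = from-mono φ ; from-mono = to-mono φ }

    ≅⇒OrderIso : D ≅ᵈᶜᵖᵒ E → OrderIso D E
    ≅⇒OrderIso (f , g , gf , fg , cf , cg) =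
      record { to = f ; from = g ; from-to = gf ; to-from = fg
             ; to-mono = continuous⇒monotone D E f cf ; from-mono = continuous⇒monotone E D g cg }

    to-⊑-adjoint : (φ : OrderIso D E) {x : ⟨ D ⟩} {y : ⟨ E ⟩}
                 → to φ x E.⊑ y → x D.⊑ from φ y
    to-⊑-adjoint φ {x} p = subst (D._⊑ _) (from-to φ x) (from-mono φ _ _ p)

    ⊑-from-adjoint : (φ : OrderIso D E) {x : ⟨ D ⟩} {y : ⟨ E ⟩}
                   → x D.⊑ from φ y → to φ x E.⊑ y
    ⊑-from-adjoint φ {y = y} p = subst (_ E.⊑_) (to-from φ y) (to-mono φ _ _ p)

    order-iso-preserves-sup : (φ : OrderIso D E) → ∀ {𝓘} {I : Set 𝓘} {α : I → ⟨ D ⟩} {x : ⟨ D ⟩}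
                            → is-sup D._⊑_ x α → is-sup E._⊑_ (to φ x) (to φ ∘ α)
    order-iso-preserves-sup φ (ub , least) =
        (λ i → to-mono φ _ _ (ub i))
      , λ y ub' → ⊑-from-adjoint φ (least (from φ y) λ i → to-⊑-adjoint φ (ub' i))

  module _ {V 𝓤 𝓣 𝓤' 𝓣'} {D : Dcpo V 𝓤 𝓣} {E : Dcpo V 𝓤' 𝓣'} where
    private
      module D = Dcpo D
      module E = Dcpo E
    open OrderIso

    OrderIso⇒≅ : OrderIso D E → D ≅ᵈᶜᵖᵒ E
    OrderIso⇒≅ φ = to φ , from φ , from-to φ , to-from φ
                 , (λ α δ → order-iso-preserves-sup φ (D.∐-is-sup α δ))
                 , (λ α δ → order-iso-preserves-sup (OrderIso-sym φ) (E.∐-is-sup α δ))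

    order-iso-preserves-≪ : (φ : OrderIso D E) {x y : ⟨ D ⟩}
                          → way-below D x y → way-below E (to φ x) (to φ y)
    order-iso-preserves-≪ φ {y = y} w α δ p =
      ∥∥-map (λ (i , q) → i , ⊑-from-adjoint φ q) (w (from φ ∘ α) δ' y⊑∐)
      where
        δ' : is-directed D._⊑_ (from φ ∘ α)
        δ' = monotone-image-directed E D (from φ) (from-mono φ) α δ
        y⊑∐ : y D.⊑ D.∐ (from φ ∘ α) δ'
        y⊑∐ = D.⊑-trans _ _ _ (to-⊑-adjoint φ p)
                (proj₂ (order-iso-preserves-sup (OrderIso-sym φ) (E.∐-is-sup α δ)) _
                       (proj₁ (D.∐-is-sup _ δ')))

  module _ {V 𝓤 𝓣 𝓤' 𝓣'} {D : Dcpo V 𝓤 𝓣} {E : Dcpo V 𝓤' 𝓣'} where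
    private
      module D = Dcpo D
      module E = Dcpo E
    open OrderIso

    to-≪-adjoint : (φ : OrderIso D E) {x : ⟨ D ⟩} {y : ⟨ E ⟩}
                 → way-below E (to φ x) y → way-below D x (from φ y)
    to-≪-adjoint φ {x} w =
      subst (λ z → way-below D z _) (from-to φ x) (order-iso-preserves-≪ (OrderIso-sym φ) w)

    ≪-from-adjoint : (φ : OrderIso D E) {x : ⟨ D ⟩} {y : ⟨ E ⟩}
                   → way-below D x (from φ y) → way-below E (to φ x) y
    ≪-from-adjoint φ {y = y} w = subst (way-below E _) (to-from φ y) (order-iso-preserves-≪ φ w)

    small-basis-transport : (φ : OrderIso D E) {B : Set V} {β : B → ⟨ D ⟩}
                          → is-small-basis D β → is-small-basis E (to φ ∘ β)
    small-basis-transport φ {B} {β} (sm , dir , sup) =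
        (λ b y → is-small-resp-⇔ (sm b (from φ y)) (≪-isProp D _ _) (≪-isProp E _ _)
                                 (≪-from-adjoint φ) (to-≪-adjoint φ))
      , (λ y → proj₁ (approximated y)) , (λ y → proj₂ (approximated y))
      where
        approximated : ∀ y → is-directed-sup E y (λ (p : Σ B λ b → way-below E (to φ (β b)) y)
                                                    → to φ (β (proj₁ p)))
        approximated y =
          Σ-directed-sup-⇔ E (to φ ∘ β) (λ _ → ≪-from-adjoint φ) (λ _ → to-≪-adjoint φ)
            ( monotone-image-directed D E (to φ) (to-mono φ) _ (dir (from φ y))
            , subst (λ z → is-sup E._⊑_ z _) (to-from φ y)
                    (order-iso-preserves-sup φ (sup (from φ y))))

  module _ {V 𝓤 𝓣} (D : Dcpo V 𝓤 𝓣) {B : Set V} {β : B → ⟨ D ⟩} where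
    open Dcpo D

    small-compact-basis⇒small-basis : is-small-compact-basis D β → is-small-basis D β
    small-compact-basis⇒small-basis (κ , sm , dir , sup) =
        (λ b x → is-small-resp-⇔ (sm b x) (⊑-prop _ _) (≪-isProp D _ _) (≪-⊑-trans D (κ b)) (≪⇒⊑ D))
      , (λ x → proj₁ (approximated x)) , (λ x → proj₂ (approximated x))
      where
        approximated : ∀ x → is-directed-sup D x (λ (p : Σ B λ b → way-below D (β b) x) → β (proj₁ p))
        approximated x =
          Σ-directed-sup-⇔ D β (λ b → ≪-⊑-trans D (κ b)) (λ _ → ≪⇒⊑ D) (dir x , sup x)

    small-basis-of-compacts : (∀ b → is-compact D (β b)) → is-small-basis D β
                            → is-small-compact-basis D β
    small-basis-of-compacts κ (sm , dir , sup) =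
        κ
      , (λ b x → is-small-resp-⇔ (sm b x) (≪-isProp D _ _) (⊑-prop _ _) (≪⇒⊑ D) (≪-⊑-trans D (κ b)))
      , (λ x → proj₁ (approximated x)) , (λ x → proj₂ (approximated x))
      where
        approximated : ∀ x → is-directed-sup D x (λ (p : Σ B λ b → β b ⊑ x) → β (proj₁ p))
        approximated x =
          Σ-directed-sup-⇔ D β (λ _ → ≪⇒⊑ D) (λ b → ≪-⊑-trans D (κ b)) (dir x , sup x)

  module Ideals {V} {B : Set V} (_≺_ : B → B → Set V) where
    open IdealCompletion _≺_ public using (Idl; _⊆_)
    open IdealCompletion _≺_ using (_∈_)

    _∈ᴵ_ : B → Idl → Set V
    b ∈ᴵ I = b ∈ proj₁ I

    ∈-isProp : (I : Idl) (b : B) → isProp (b ∈ᴵ I)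
    ∈-isProp I b = proj₂ (proj₁ I b)

    ideal-lower : (I : Idl) {a b : B} → a ≺ b → b ∈ᴵ I → a ∈ᴵ I
    ideal-lower I = proj₁ (proj₂ I) _ _

    ideal-inhabited : (I : Idl) → ∃∥ λ b → b ∈ᴵ I
    ideal-inhabited I = proj₁ (proj₂ (proj₂ I))

    ideal-semidirected : (I : Idl) {a b : B} → a ∈ᴵ I → b ∈ᴵ I
                       → ∃∥ λ c → c ∈ᴵ I × a ≺ c × b ≺ c
    ideal-semidirected I = proj₂ (proj₂ (proj₂ I)) _ _

    ideal-rounded : (I : Idl) {b : B} → b ∈ᴵ I → ∃∥ λ c → c ∈ᴵ I × b ≺ c
    ideal-rounded I m = ∥∥-map (λ (c , m' , r , _) → c , m' , r) (ideal-semidirected I m m)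

    ideal-family-directed : ∀ {𝓤 𝓣} {C : Set 𝓤} (_⊑_ : C → C → Set 𝓣) (γ : B → C)
                          → (∀ {a b} → a ≺ b → γ a ⊑ γ b)
                          → (I : Idl) → is-directed _⊑_ (λ (p : Σ B (_∈ᴵ I)) → γ (proj₁ p))
    ideal-family-directed _⊑_ γ γ-mono I =
        ideal-inhabited I
      , λ (a , ma) (b , mb) →
          ∥∥-map (λ (c , mc , ac , bc) → (c , mc) , γ-mono ac , γ-mono bc)
                 (ideal-semidirected I ma mb)

    module Principal (ab : is-abstract-basis _≺_) where
      private
        Idl-D = Idl-DCPO _≺_

      infix 25 ↓_
      ↓_ : B → Idl
      ↓ b = (λ a → a ≺ b , proj₁ ab a b)
          , (λ a c r m → proj₁ (proj₂ ab) a c b r m)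
          , proj₁ (proj₂ (proj₂ ab)) b
          , λ a c ra rc → ∥∥-map (λ (d , ad , cd , db) → d , db , ad , cd)
                                 (proj₂ (proj₂ (proj₂ ab)) a c b ra rc)

      ↓-mono : ∀ {a b} → a ≺ b → ↓ a ⊆ ↓ b
      ↓-mono r c m = proj₁ (proj₂ ab) c _ _ m r

      ↓-≪ : {c : B} (I : Idl) → c ∈ᴵ I → way-below Idl-D (↓ c) I
      ↓-≪ I m α δ p = ∥∥-map (λ (i , m') → i , λ a ac → ideal-lower (α i) ac m') (p _ m)

      principals : (I : Idl) → Σ B (_∈ᴵ I) → Idl
      principals I (c , _) = ↓ c

      ideal-directed-sup-of-principals : (I : Idl) → is-directed-sup Idl-D I (principals I)
      ideal-directed-sup-of-principals I =
          ideal-family-directed _⊆_ ↓_ ↓-mono I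
        , (λ (c , m) a ac → ideal-lower I ac m)
        , λ J ub a m →
            ∥∥-rec (∈-isProp J a) (λ (c , mc , ac) → ub (c , mc) a ac) (ideal-rounded I m)

      ≪-↓ : {b : B} (I : Idl) → way-below Idl-D (↓ b) I → ∃∥ λ c → c ∈ᴵ I × ↓ b ⊆ ↓ c
      ≪-↓ I w = ∥∥-map (λ ((c , m) , p) → c , m , p) (w (principals I) δ I⊆∐)
        where
          δ : is-directed _⊆_ (principals I)
          δ = proj₁ (ideal-directed-sup-of-principals I)
          I⊆∐ : I ⊆ Dcpo.∐ Idl-D (principals I) δ
          I⊆∐ = proj₂ (proj₂ (ideal-directed-sup-of-principals I)) (Dcpo.∐ Idl-D (principals I) δ)
                       (proj₁ (Dcpo.∐-is-sup Idl-D (principals I) δ))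

      ↓-approximants : (I : Idl) → Σ B (λ b → way-below Idl-D (↓ b) I) → Idl
      ↓-approximants I (b , _) = ↓ b

      ↓-small-basis : is-small-basis Idl-D ↓_
      ↓-small-basis = small , (λ I → proj₁ (approximated I)) , (λ I → proj₂ (approximated I))
        where
          small : ∀ b I → is-small V (way-below Idl-D (↓ b) I)
          small b I = (∃∥ λ c → c ∈ᴵ I × ↓ b ⊆ ↓ c)
                    , prop-⇔→↔ ∥∥-isProp (≪-isProp Idl-D (↓ b) I)
                        (∥∥-rec (≪-isProp Idl-D (↓ b) I) λ (c , m , p) →
                           ⊑-≪-trans Idl-D {↓ b} {↓ c} {I} p (↓-≪ I m))
                        (≪-↓ I)
          approximated : ∀ I → is-directed-sup Idl-D I (↓-approximants I)
          -- ∥_∥ is an opaque field, so types under ∣_∣ and ∥∥-map cannot be inferred here.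
          approximated I =
            cofinal-directed-sup Idl-D {α = principals I} {↓-approximants I} {I}
              (ideal-directed-sup-of-principals I)
              (λ (c , m) → ∣ (c , λ {_} → ↓-≪ I m) , (λ _ r → r) ∣)
              (λ (b , w) → ∥∥-map {C = Σ (Σ B (_∈ᴵ I)) λ p → ↓ b ⊆ principals I p}
                                  (λ (c , m , p) → (c , m) , p) (≪-↓ I w))

      ↓-compact : (∀ b → b ≺ b) → ∀ b → is-compact Idl-D (↓ b)
      ↓-compact ≺-refl b = ↓-≪ (↓ b) (≺-refl b)

  module FromSmallBasis {V 𝓤 𝓣} (D : Dcpo V 𝓤 𝓣) {B : Set V} (β : B → ⟨ D ⟩)
                        (bas : is-small-basis D β) where
    open Dcpo D

    _≪ₛ_ : B → Carrier → Set V
    b ≪ₛ x = proj₁ (proj₁ bas b x)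

    ≪ₛ⇒≪ : ∀ {b x} → b ≪ₛ x → way-below D (β b) x
    ≪ₛ⇒≪ {b} {x} = Inverse.to (proj₂ (proj₁ bas b x))

    ≪⇒≪ₛ : ∀ {b x} → way-below D (β b) x → b ≪ₛ x
    ≪⇒≪ₛ {b} {x} = Inverse.from (proj₂ (proj₁ bas b x))

    ≪ₛ-isProp : ∀ b x → isProp (b ≪ₛ x)
    ≪ₛ-isProp b x = isProp-↔ (proj₂ (proj₁ bas b x)) (≪-isProp D _ _)

    ≪ₛ-⊑-trans : ∀ {b x y} → b ≪ₛ x → x ⊑ y → b ≪ₛ y
    ≪ₛ-⊑-trans p q = ≪⇒≪ₛ (≪-⊑-trans D (≪ₛ⇒≪ p) q)

    ⊑-≪ₛ-trans : ∀ {a b x} → β a ⊑ β b → b ≪ₛ x → a ≪ₛ x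
    ⊑-≪ₛ-trans p q = ≪⇒≪ₛ (⊑-≪-trans D p (≪ₛ⇒≪ q))

    _≺_ : B → B → Set V
    a ≺ b = a ≪ₛ β b

    ≺⇒⊑ : ∀ {a b} → a ≺ b → β a ⊑ β b
    ≺⇒⊑ r = ≪⇒⊑ D (≪ₛ⇒≪ r)

    ↡ₛ-directed-sup : ∀ x → is-directed-sup D x (λ (p : Σ B (_≪ₛ x)) → β (proj₁ p))
    ↡ₛ-directed-sup x =
      Σ-directed-sup-⇔ D β (λ _ → ≪⇒≪ₛ) (λ _ → ≪ₛ⇒≪) (proj₁ (proj₂ bas) x , proj₂ (proj₂ bas) x)

    ↡ₛ-inhabited : ∀ x → ∃∥ λ b → b ≪ₛ x
    ↡ₛ-inhabited x = proj₁ (proj₁ (↡ₛ-directed-sup x))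

    ↡ₛ-least : ∀ {x y} → (∀ b → b ≪ₛ x → β b ⊑ y) → x ⊑ y
    ↡ₛ-least {x} h = proj₂ (proj₂ (↡ₛ-directed-sup x)) _ λ (b , p) → h b p

    approximation : ∀ {a x} → a ≪ₛ x → ∃∥ λ b → b ≪ₛ x × β a ⊑ β b
    approximation {x = x} p =
      ∥∥-map (λ ((b , q) , r) → b , q , r)
        (≪ₛ⇒≪ p _ δ (↡ₛ-least λ b q → proj₁ (∐-is-sup _ δ) (b , q)))
      where
        δ : is-directed _⊑_ (λ (p : Σ B (_≪ₛ x)) → β (proj₁ p))
        δ = proj₁ (↡ₛ-directed-sup x)

    approximation₂ : ∀ {a₁ a₂ x} → a₁ ≪ₛ x → a₂ ≪ₛ x
                   → ∃∥ λ b → b ≪ₛ x × β a₁ ⊑ β b × β a₂ ⊑ β b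
    approximation₂ {x = x} p₁ p₂ =
      ∥∥-bind (λ (b₁ , q₁ , a₁⊑b₁) → ∥∥-bind (λ (b₂ , q₂ , a₂⊑b₂) →
        ∥∥-map (λ ((b , q) , b₁⊑b , b₂⊑b) →
                  b , q , ⊑-trans _ _ _ a₁⊑b₁ b₁⊑b , ⊑-trans _ _ _ a₂⊑b₂ b₂⊑b)
               (proj₂ (proj₁ (↡ₛ-directed-sup x)) (b₁ , q₁) (b₂ , q₂)))
        (approximation p₂)) (approximation p₁)

    module _ (x : Carrier) where
      private
        Approximants² : Set V
        Approximants² = Σ (Σ B (_≪ₛ x)) λ p → Σ B (_≪ₛ β (proj₁ p))

        approximant² : Approximants² → Carrier
        approximant² (_ , (c , _)) = β c

        approximant²-directed : is-directed _⊑_ approximant²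
        approximant²-directed =
            ∥∥-bind (λ (b , p) → ∥∥-map (λ q → (b , p) , q) (↡ₛ-inhabited (β b))) (↡ₛ-inhabited x)
          , λ ((b₁ , p₁) , (c₁ , q₁)) ((b₂ , p₂) , (c₂ , q₂)) →
              ∥∥-bind (λ ((b , p) , b₁⊑b , b₂⊑b) →
                ∥∥-map (λ (c , q , c₁⊑c , c₂⊑c) → ((b , p) , (c , q)) , c₁⊑c , c₂⊑c)
                       (approximation₂ (≪ₛ-⊑-trans q₁ b₁⊑b) (≪ₛ-⊑-trans q₂ b₂⊑b)))
                (proj₂ (proj₁ (↡ₛ-directed-sup x)) (b₁ , p₁) (b₂ , p₂))

        ⊑-∐-approximant² : x ⊑ ∐ approximant² approximant²-directed
        ⊑-∐-approximant² =
          ↡ₛ-least λ b p → ↡ₛ-least λ c q → proj₁ (∐-is-sup _ _) ((b , p) , (c , q))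

      interpolation : ∀ {a} → a ≪ₛ x → ∃∥ λ b → a ≺ b × b ≪ₛ x
      interpolation p =
        ∥∥-map (λ (((b , q) , (c , r)) , a⊑c) → b , ⊑-≪ₛ-trans a⊑c r , q)
               (≪ₛ⇒≪ p approximant² approximant²-directed ⊑-∐-approximant²)

    interpolation₂ : ∀ {a₁ a₂ x} → a₁ ≪ₛ x → a₂ ≪ₛ x → ∃∥ λ b → a₁ ≺ b × a₂ ≺ b × b ≪ₛ x
    interpolation₂ {x = x} p₁ p₂ =
      ∥∥-bind (λ (b₁ , a₁≺b₁ , q₁) → ∥∥-bind (λ (b₂ , a₂≺b₂ , q₂) →
        ∥∥-map (λ (b , q , b₁⊑b , b₂⊑b) → b , ≪ₛ-⊑-trans a₁≺b₁ b₁⊑b , ≪ₛ-⊑-trans a₂≺b₂ b₂⊑b , q)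
               (approximation₂ q₁ q₂))
        (interpolation x p₂)) (interpolation x p₁)

    ≺-≪ₛ-trans : ∀ {a b x} → a ≺ b → b ≪ₛ x → a ≪ₛ x
    ≺-≪ₛ-trans r = ⊑-≪ₛ-trans (≺⇒⊑ r)

    ≺-abstract-basis : is-abstract-basis _≺_
    ≺-abstract-basis =
        (λ a b → ≪ₛ-isProp a (β b))
      , (λ a b c → ≺-≪ₛ-trans)
      , (λ a → ↡ₛ-inhabited (β a))
      , (λ a₁ a₂ b → interpolation₂)

    open Ideals _≺_

    ↡ₛ-ideal : Carrier → Idl
    ↡ₛ-ideal x = (λ b → b ≪ₛ x , ≪ₛ-isProp b x)
               , (λ a b → ≺-≪ₛ-trans)
               , ↡ₛ-inhabited x
               , λ a b p q → ∥∥-map (λ (c , a≺c , b≺c , r) → c , r , a≺c , b≺c)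
                                    (interpolation₂ {x = x} p q)

    ∐ᴵ-directed : (I : Idl) → is-directed _⊑_ (λ (p : Σ B (_∈ᴵ I)) → β (proj₁ p))
    ∐ᴵ-directed = ideal-family-directed _⊑_ β ≺⇒⊑

    ∐ᴵ : Idl → Carrier
    ∐ᴵ I = ∐ _ (∐ᴵ-directed I)

    ∐ᴵ-ub : (I : Idl) {b : B} → b ∈ᴵ I → β b ⊑ ∐ᴵ I
    ∐ᴵ-ub I {b} m = proj₁ (∐-is-sup _ (∐ᴵ-directed I)) (b , m)

    ∐ᴵ-mono : ∀ I J → I ⊆ J → ∐ᴵ I ⊑ ∐ᴵ J
    ∐ᴵ-mono I J p = proj₂ (∐-is-sup _ (∐ᴵ-directed I)) _ λ (b , m) → ∐ᴵ-ub J (p b m)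

    ∐ᴵ-↡ₛ-ideal : ∀ x → ∐ᴵ (↡ₛ-ideal x) ≡ x
    ∐ᴵ-↡ₛ-ideal x = ∐-unique D _ _ (proj₂ (↡ₛ-directed-sup x))

    ↡ₛ-ideal-∐ᴵ : ∀ I → ↡ₛ-ideal (∐ᴵ I) ≡ I
    ↡ₛ-ideal-∐ᴵ I = Dcpo.⊑-antisym (Idl-DCPO _≺_) _ _ ⊆I I⊆
      where
        ⊆I : ↡ₛ-ideal (∐ᴵ I) ⊆ I
        ⊆I b p =
          ∥∥-rec (∈-isProp I b)
            (λ ((c , m) , b⊑c) →
               ∥∥-rec (∈-isProp I b)
                 (λ (c' , m' , c≺c') → ideal-lower I (⊑-≪ₛ-trans b⊑c c≺c') m')
                 (ideal-rounded I m))
            (≪ₛ⇒≪ {b} {∐ᴵ I} p _ (∐ᴵ-directed I) (⊑-refl _))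
        I⊆ : I ⊆ ↡ₛ-ideal (∐ᴵ I)
        I⊆ b m =
          ∥∥-rec (≪ₛ-isProp b _)
            (λ (c , m' , b≺c) → ≪ₛ-⊑-trans {x = β c} b≺c (∐ᴵ-ub I m'))
            (ideal-rounded I m)

    ↡ₛ-order-iso : OrderIso D (Idl-DCPO _≺_)
    ↡ₛ-order-iso = record
      { to        = ↡ₛ-ideal
      ; from      = ∐ᴵ
      ; from-to   = ∐ᴵ-↡ₛ-ideal
      ; to-from   = ↡ₛ-ideal-∐ᴵ
      ; to-mono   = λ x y p b q → ≪ₛ-⊑-trans q p
      ; from-mono = ∐ᴵ-mono
      }

  module _ {V 𝓤 𝓣} (D : Dcpo V 𝓤 𝓣) {B : Set V} where

    small-basis⇒ideal-completion : (β : B → ⟨ D ⟩) → is-small-basis D β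
      → Σ (B → B → Set V) λ _≺_ → is-abstract-basis _≺_ × (D ≅ᵈᶜᵖᵒ Idl-DCPO _≺_)
    small-basis⇒ideal-completion β bas = _≺_ , ≺-abstract-basis , OrderIso⇒≅ ↡ₛ-order-iso
      where open FromSmallBasis D β bas

    small-compact-basis⇒ideal-completion : (β : B → ⟨ D ⟩) → is-small-compact-basis D β
      → Σ (B → B → Set V) λ _≺_ → is-abstract-basis _≺_ × (∀ b → b ≺ b) × (D ≅ᵈᶜᵖᵒ Idl-DCPO _≺_)
    small-compact-basis⇒ideal-completion β cbas =
      _≺_ , ≺-abstract-basis , (λ b → ≪⇒≪ₛ (proj₁ cbas b)) , OrderIso⇒≅ ↡ₛ-order-iso
      where open FromSmallBasis D β (small-compact-basis⇒small-basis D cbas)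

    ideal-completion⇒small-basis : {_≺_ : B → B → Set V} → is-abstract-basis _≺_
      → D ≅ᵈᶜᵖᵒ Idl-DCPO _≺_ → Σ (B → ⟨ D ⟩) (is-small-basis D)
    ideal-completion⇒small-basis {_≺_} ab iso =
      OrderIso.to φ ∘ ↓_ , small-basis-transport φ ↓-small-basis
      where
        open Ideals.Principal _≺_ ab
        φ : OrderIso (Idl-DCPO _≺_) D
        φ = OrderIso-sym (≅⇒OrderIso iso)

    ideal-completion⇒small-compact-basis : {_≺_ : B → B → Set V} → is-abstract-basis _≺_
      → (∀ b → b ≺ b) → D ≅ᵈᶜᵖᵒ Idl-DCPO _≺_ → Σ (B → ⟨ D ⟩) (is-small-compact-basis D)
    ideal-completion⇒small-compact-basis {_≺_} ab ≺-refl iso =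
        OrderIso.to φ ∘ ↓_
      , small-basis-of-compacts D (λ b → order-iso-preserves-≪ φ {↓ b} {↓ b} (↓-compact ≺-refl b))
                                  (small-basis-transport φ ↓-small-basis)
      where
        open Ideals.Principal _≺_ ab
        φ : OrderIso (Idl-DCPO _≺_) D
        φ = OrderIso-sym (≅⇒OrderIso iso)

  module _ {V 𝓤 𝓣} (D : Dcpo V 𝓤 𝓣) where

    has-small-basis⇔ideal-completion :
      has-small-basis D ⇔ (∃∥ λ (B : Set V) → Σ (B → B → Set V) λ _≺_ →
                             is-abstract-basis _≺_ × (D ≅ᵈᶜᵖᵒ Idl-DCPO _≺_))
    has-small-basis⇔ideal-completion =
      mk⇔ (∥∥-map λ (B , β , bas) → B , small-basis⇒ideal-completion D β bas)
          (∥∥-map λ (B , _ , ab , iso) → B , ideal-completion⇒small-basis D ab iso)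

    has-small-compact-basis⇔reflexive-ideal-completion :
      has-small-compact-basis D ⇔ (∃∥ λ (B : Set V) → Σ (B → B → Set V) λ _≺_ →
                                     is-abstract-basis _≺_ × (∀ b → b ≺ b) × (D ≅ᵈᶜᵖᵒ Idl-DCPO _≺_))
    has-small-compact-basis⇔reflexive-ideal-completion =
      mk⇔ (∥∥-map λ (B , β , cbas) → B , small-compact-basis⇒ideal-completion D β cbas)
          (∥∥-map λ (B , _ , ab , ≺-refl , iso) →
                     B , ideal-completion⇒small-compact-basis D ab ≺-refl iso)

mainTheorem16 : (pt : PropTrunc) (fe : FunExt) (pe : PropExt)
    → let open WithAx pt fe pe in
      ∀ {V 𝓤 𝓣 : Level} (D : Dcpo V 𝓤 𝓣)
    → (has-small-basis D
        ⇔ (∃∥ λ (B : Set V) → Σ (B → B → Set V) λ _≺_ →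
             is-abstract-basis _≺_ × (D ≅ᵈᶜᵖᵒ Idl-DCPO _≺_)))
    × (has-small-compact-basis D
        ⇔ (∃∥ λ (B : Set V) → Σ (B → B → Set V) λ _≺_ →
             is-abstract-basis _≺_ × (∀ b → b ≺ b) × (D ≅ᵈᶜᵖᵒ Idl-DCPO _≺_)))
    × (has-small-basis D
        → ∃∥ λ (E : Dcpo V (lsuc V) V) → D ≅ᵈᶜᵖᵒ E)
mainTheorem16 pt fe pe D =
    has-small-basis⇔ideal-completion D
  , has-small-compact-basis⇔reflexive-ideal-completion D
  , ∥∥-map (λ (_ , _≺_ , _ , iso) → Idl-DCPO _≺_ , iso)
    ∘ Equivalence.to (has-small-basis⇔ideal-completion D)
  where
    open WithAx pt fe pe
    open DomainTheory pt fe pe
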